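{- Let $v\ge 3$ and let $K_{v,v}-I$ denote the complete bipartite graph $K_{v,v}$ with a perfect matching removed. Then the metric dimension of $K_{v,v}-I$ is $v-1$.
   Context: The metric dimension of a connected graph is the minimum size of a vertex set $R$ such that any two distinct vertices $x,y$ have some $w\in R$ with $\d(x,w)\ne\d(y,w)$, where $\d$ is the path distance. -}

module Defs where

open import Data.Nat using (ℕ; zero; suc; _≤_)
open import Data.Fin using (Fin; splitAt)
open import Data.Fin.Subset using (Subset; _∈_; ∣_∣)
open import Data.Sum using (_⊎_; inj₁; inj₂)
open import Data.Product using (_×_; ∃-syntax)
open import Data.Empty using (⊥)
open import Relation.Binary.PropositionalEquality using (_≡_; _≢_)

Graph : ℕ → Set₁
Graph n = Fin n → Fin n → Set

data Walk {n : ℕ} (G : Graph n) : Fin n → Fin n → ℕ → Set where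
  here : ∀ {x} → Walk G x x zero
  step : ∀ {x y z k} → G x y → Walk G y z k → Walk G x z (suc k)

IsDist : ∀ {n} → Graph n → Fin n → Fin n → ℕ → Set
IsDist G x y k = Walk G x y k × (∀ m → Walk G x y m → k ≤ m)

Resolving : ∀ {n} → Graph n → Subset n → Set
Resolving {n} G R =
  ∀ (x y : Fin n) → x ≢ y →
    ∃[ w ] (w ∈ R × ∃[ k ] ∃[ l ] (IsDist G x w k × IsDist G y w l × k ≢ l))

MetricDimension : ∀ {n} → Graph n → ℕ → Set
MetricDimension {n} G d =
  (∃[ R ] (Resolving G R × ∣ R ∣ ≡ d)) × (∀ (R : Subset n) → Resolving G R → d ≤ ∣ R ∣)

-- K_{v,v} - I : vertices Fin (v + v); the first v are the side a_0..a_{v-1},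
-- the last v the side b_0..b_{v-1}; a_i ~ b_j iff i ≢ j (matching a_i b_i removed).
KvvI-adj : ∀ {v} → Fin v ⊎ Fin v → Fin v ⊎ Fin v → Set
KvvI-adj (inj₁ i) (inj₂ j) = i ≢ j
KvvI-adj (inj₂ i) (inj₁ j) = i ≢ j
KvvI-adj (inj₁ _) (inj₁ _) = ⊥
KvvI-adj (inj₂ _) (inj₂ _) = ⊥

KvvI : (v : ℕ) → Graph (v Data.Nat.+ v)
KvvI v x y = KvvI-adj (splitAt v x) (splitAt v y)

-- Write a_i, b_i for the two sides. Distances in K_{v,v} − I depend only on whether two
-- vertices lie on the same side and have the same index: 0 and 2 on one side, 1 and 3 across
-- (the detour a_i b_k a_l b_i needs a third index, hence v ≥ 3). The landmarks a_1 … a_{v-1}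
-- resolve: sides are told apart by parity, and two vertices on one side by the landmark
-- carrying the nonzero one of their indices. Conversely a_i and a_j are equidistant from every
-- vertex whose index is neither i nor j, so a resolving set has a vertex of index i or j for
-- all i ≢ j; hence it covers all indices but at most one.
module Submission where

open import Defs
open import Data.Nat using (ℕ; suc; _+_; _∸_; _≤_; z≤n; s≤s)
open import Data.Nat.Properties using (≤-antisym; ≤-trans; ≤-reflexive; +-identityʳ; module ≤-Reasoning; m≤n+m∸n; +-monoʳ-≤; +-suc)
open import Data.Bool using (if_then_else_)
open import Data.Fin using (Fin; splitAt; join; _↑ˡ_; _↑ʳ_; _≟_) renaming (zero to fzero; suc to fsuc)
open import Data.Fin.Properties using (suc-injective; ↑ˡ-injective; splitAt-join; join-splitAt; splitAt-↑ˡ; splitAt⁻¹-↑ˡ; splitAt⁻¹-↑ʳ)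
open import Data.Fin.Subset using (Subset; _∈_; ∣_∣; _∪_; ⊤; ⊥; inside; outside)
open import Data.Fin.Subset.Properties using (∈⊤; ∣⊤∣≡n; ∣⊥∣≡0; p⊆q⇒∣p∣≤∣q∣; ∣p∣≤∣x∷p∣; x∈p∪q⁺)
open import Data.Vec using (_∷_; []; _++_; here; there)
import Data.Vec as Vec
open import Data.Sum using (_⊎_; inj₁; inj₂; reduce)
import Data.Sum as Sum
open import Data.Product using (_×_; _,_; ∃-syntax)
open import Data.Empty using (⊥-elim)
open import Relation.Nullary using (yes; no; does)
open import Relation.Nullary.Decidable using (dec-true)
open import Relation.Binary.PropositionalEquality
open import Function using (_∘_)

private
  variable
    m n : ℕ

IsDist-unique : ∀ {G : Graph n} {x y k l} → IsDist G x y k → IsDist G x y l → k ≡ l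
IsDist-unique (walkₖ , minimalₖ) (walkₗ , minimalₗ) = ≤-antisym (minimalₖ _ walkₗ) (minimalₗ _ walkₖ)

module _ {G : Graph n} (φ : Fin n → Fin n → ℕ)
         (φ-diag : ∀ x → φ x x ≡ 0)
         (φ-step : ∀ {x y} z → G x y → φ x z ≤ suc (φ y z)) where

  potential≤length : ∀ {x y k} → Walk G x y k → φ x y ≤ k
  potential≤length {x} here = ≤-reflexive (φ-diag x)
  potential≤length (step {z = z} edge walk) = ≤-trans (φ-step z edge) (s≤s (potential≤length walk))

  IsDist-fromPotential : ∀ {x y} → Walk G x y (φ x y) → IsDist G x y (φ x y)
  IsDist-fromPotential walk = walk , λ _ → potential≤length

∣p++q∣≡∣p∣+∣q∣ : (p : Subset m) (q : Subset n) → ∣ p ++ q ∣ ≡ ∣ p ∣ + ∣ q ∣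
∣p++q∣≡∣p∣+∣q∣ []            q = refl
∣p++q∣≡∣p∣+∣q∣ (inside  ∷ p) q = cong suc (∣p++q∣≡∣p∣+∣q∣ p q)
∣p++q∣≡∣p∣+∣q∣ (outside ∷ p) q = ∣p++q∣≡∣p∣+∣q∣ p q

∣p∪q∣≤∣p∣+∣q∣ : (p q : Subset n) → ∣ p ∪ q ∣ ≤ ∣ p ∣ + ∣ q ∣
∣p∪q∣≤∣p∣+∣q∣ []            []            = z≤n
∣p∪q∣≤∣p∣+∣q∣ (inside  ∷ p) (b       ∷ q) = s≤s (≤-trans (∣p∪q∣≤∣p∣+∣q∣ p q) (+-monoʳ-≤ ∣ p ∣ (∣p∣≤∣x∷p∣ b q)))
∣p∪q∣≤∣p∣+∣q∣ (outside ∷ p) (inside  ∷ q) = ≤-trans (s≤s (∣p∪q∣≤∣p∣+∣q∣ p q)) (≤-reflexive (sym (+-suc ∣ p ∣ ∣ q ∣)))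
∣p∪q∣≤∣p∣+∣q∣ (outside ∷ p) (outside ∷ q) = ∣p∪q∣≤∣p∣+∣q∣ p q

pairwise-hit⇒n∸1≤∣p∣ : (p : Subset n) → (∀ i j → i ≢ j → i ∈ p ⊎ j ∈ p) → n ∸ 1 ≤ ∣ p ∣
pairwise-hit⇒n∸1≤∣p∣ [] _ = z≤n
pairwise-hit⇒n∸1≤∣p∣ {suc n} (inside ∷ p) hit =
  ≤-trans (m≤n+m∸n n 1) (s≤s (pairwise-hit⇒n∸1≤∣p∣ p hitTail))
  where
  hitTail : ∀ i j → i ≢ j → i ∈ p ⊎ j ∈ p
  hitTail i j i≢j with hit (fsuc i) (fsuc j) (i≢j ∘ suc-injective)
  ... | inj₁ (there i∈p) = inj₁ i∈p
  ... | inj₂ (there j∈p) = inj₂ j∈p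
pairwise-hit⇒n∸1≤∣p∣ {suc n} (outside ∷ p) hit =
  ≤-trans (≤-reflexive (sym (∣⊤∣≡n n))) (p⊆q⇒∣p∣≤∣q∣ ⊤⊆p)
  where
  ⊤⊆p : ∀ {i} → i ∈ ⊤ → i ∈ p
  ⊤⊆p {i} _ with hit fzero (fsuc i) (λ ())
  ... | inj₂ (there i∈p) = i∈p

↑ˡ-∈-++⁺ : {p : Subset m} (q : Subset n) {i : Fin m} → i ∈ p → i ↑ˡ n ∈ p ++ q
↑ˡ-∈-++⁺ q here         = here
↑ˡ-∈-++⁺ q (there i∈p) = there (↑ˡ-∈-++⁺ q i∈p)

↑ˡ-∈-++⁻ : (p : Subset m) (q : Subset n) (i : Fin m) → i ↑ˡ n ∈ p ++ q → i ∈ p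
↑ˡ-∈-++⁻ (_ ∷ p) q fzero    here        = here
↑ˡ-∈-++⁻ (_ ∷ p) q (fsuc i) (there i∈p) = there (↑ˡ-∈-++⁻ p q i i∈p)

↑ʳ-∈-++⁻ : (p : Subset m) (q : Subset n) (j : Fin n) → m ↑ʳ j ∈ p ++ q → j ∈ q
↑ʳ-∈-++⁻ []      q j j∈q         = j∈q
↑ʳ-∈-++⁻ (_ ∷ p) q j (there j∈q) = ↑ʳ-∈-++⁻ p q j j∈q

∈-++⇒reduce-splitAt-∈-∪ : (p q : Subset n) (x : Fin (n + n)) → x ∈ p ++ q → reduce (splitAt n x) ∈ p ∪ q
∈-++⇒reduce-splitAt-∈-∪ {n} p q x x∈ with splitAt n x in eq
... | inj₁ i = x∈p∪q⁺ (inj₁ (↑ˡ-∈-++⁻ p q i (subst (_∈ p ++ q) (sym (splitAt⁻¹-↑ˡ eq)) x∈)))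
... | inj₂ j = x∈p∪q⁺ (inj₂ (↑ʳ-∈-++⁻ p q j (subst (_∈ p ++ q) (sym (splitAt⁻¹-↑ʳ eq)) x∈)))

δ : Fin n ⊎ Fin n → Fin n ⊎ Fin n → ℕ
δ (inj₁ i) (inj₁ j) = if does (i ≟ j) then 0 else 2
δ (inj₂ i) (inj₂ j) = if does (i ≟ j) then 0 else 2
δ (inj₁ i) (inj₂ j) = if does (i ≟ j) then 3 else 1
δ (inj₂ i) (inj₁ j) = if does (i ≟ j) then 3 else 1

δ-diag : (s : Fin n ⊎ Fin n) → δ s s ≡ 0
δ-diag (inj₁ i) rewrite dec-true (i ≟ i) refl = refl
δ-diag (inj₂ i) rewrite dec-true (i ≟ i) refl = refl

δ-step : ∀ {s t : Fin n ⊎ Fin n} u → KvvI-adj s t → δ s u ≤ suc (δ t u)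
δ-step {s = inj₁ i} {inj₂ j} (inj₁ k) i≢j with i ≟ k | j ≟ k
... | yes _ | _     = z≤n
... | no _  | yes _ = s≤s (s≤s z≤n)
... | no _  | no _  = s≤s (s≤s z≤n)
δ-step {s = inj₁ i} {inj₂ j} (inj₂ k) i≢j with i ≟ k | j ≟ k
... | yes refl | yes refl = ⊥-elim (i≢j refl)
... | yes _    | no _     = s≤s (s≤s (s≤s z≤n))
... | no _     | _        = s≤s z≤n
δ-step {s = inj₂ i} {inj₁ j} (inj₁ k) i≢j with i ≟ k | j ≟ k
... | yes refl | yes refl = ⊥-elim (i≢j refl)
... | yes _    | no _     = s≤s (s≤s (s≤s z≤n))
... | no _     | _        = s≤s z≤n
δ-step {s = inj₂ i} {inj₁ j} (inj₂ k) i≢j with i ≟ k | j ≟ k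
... | yes _ | _     = z≤n
... | no _  | yes _ = s≤s (s≤s z≤n)
... | no _  | no _  = s≤s (s≤s z≤n)

δ-parity : (i j k : Fin n) → δ (inj₁ i) (inj₁ k) ≢ δ (inj₂ j) (inj₁ k)
δ-parity i j k with i ≟ k | j ≟ k
... | yes _ | yes _ = λ ()
... | yes _ | no _  = λ ()
... | no _  | yes _ = λ ()
... | no _  | no _  = λ ()

δ-a-index : (k t : Fin n) → t ≢ k → δ (inj₁ k) (inj₁ k) ≢ δ (inj₁ t) (inj₁ k)
δ-a-index k t t≢k with k ≟ k | t ≟ k
... | no k≢k | _        = ⊥-elim (k≢k refl)
... | yes _  | yes t≡k = ⊥-elim (t≢k t≡k)
... | yes _  | no _     = λ ()

δ-b-index : (k t : Fin n) → t ≢ k → δ (inj₂ k) (inj₁ k) ≢ δ (inj₂ t) (inj₁ k)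
δ-b-index k t t≢k with k ≟ k | t ≟ k
... | no k≢k | _        = ⊥-elim (k≢k refl)
... | yes _  | yes t≡k = ⊥-elim (t≢k t≡k)
... | yes _  | no _     = λ ()

-- Landmarks have nonzero index, so a vertex of index 0 is separated from another vertex on
-- its side by the landmark carrying the other's index.
δ-separates : (s t : Fin (2 + n) ⊎ Fin (2 + n)) → s ≢ t →
              ∃[ k ] (δ s (inj₁ (fsuc k)) ≢ δ t (inj₁ (fsuc k)))
δ-separates (inj₁ i) (inj₂ j) _ = fzero , δ-parity i j (fsuc fzero)
δ-separates (inj₂ i) (inj₁ j) _ = fzero , δ-parity j i (fsuc fzero) ∘ sym
δ-separates (inj₁ fzero)    (inj₁ fzero)    s≢t = ⊥-elim (s≢t refl)
δ-separates (inj₁ fzero)    (inj₁ (fsuc j)) _   = j , δ-a-index (fsuc j) fzero (λ ()) ∘ sym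
δ-separates (inj₁ (fsuc i)) (inj₁ t)        s≢t = i , δ-a-index (fsuc i) t (s≢t ∘ cong inj₁ ∘ sym)
δ-separates (inj₂ fzero)    (inj₂ fzero)    s≢t = ⊥-elim (s≢t refl)
δ-separates (inj₂ fzero)    (inj₂ (fsuc j)) _   = j , δ-b-index (fsuc j) fzero (λ ()) ∘ sym
δ-separates (inj₂ (fsuc i)) (inj₂ t)        s≢t = i , δ-b-index (fsuc i) t (s≢t ∘ cong inj₂ ∘ sym)

δ-a-distinguisher-index : (i j : Fin n) (u : Fin n ⊎ Fin n) →
                          δ (inj₁ i) u ≢ δ (inj₁ j) u → reduce u ≡ i ⊎ reduce u ≡ j
δ-a-distinguisher-index i j (inj₁ k) distinct with i ≟ k | j ≟ k
... | yes i≡k | _       = inj₁ (sym i≡k)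
... | no _    | yes j≡k = inj₂ (sym j≡k)
... | no _    | no _    = ⊥-elim (distinct refl)
δ-a-distinguisher-index i j (inj₂ k) distinct with i ≟ k | j ≟ k
... | yes i≡k | _       = inj₁ (sym i≡k)
... | no _    | yes j≡k = inj₂ (sym j≡k)
... | no _    | no _    = ⊥-elim (distinct refl)

third : (i j : Fin (3 + n)) → ∃[ k ] (k ≢ i × k ≢ j)
third fzero fzero = fsuc fzero , (λ ()) , (λ ())
third fzero (fsuc fzero) = fsuc (fsuc fzero) , (λ ()) , (λ ())
third fzero (fsuc (fsuc _)) = fsuc fzero , (λ ()) , (λ ())
third (fsuc fzero) fzero = fsuc (fsuc fzero) , (λ ()) , (λ ())
third (fsuc fzero) (fsuc fzero) = fzero , (λ ()) , (λ ())
third (fsuc fzero) (fsuc (fsuc _)) = fzero , (λ ()) , (λ ())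
third (fsuc (fsuc _)) fzero = fsuc fzero , (λ ()) , (λ ())
third (fsuc (fsuc _)) (fsuc fzero) = fzero , (λ ()) , (λ ())
third (fsuc (fsuc _)) (fsuc (fsuc _)) = fzero , (λ ()) , (λ ())

join-step : ∀ {v} (s t : Fin v ⊎ Fin v) {z k} → KvvI-adj s t →
            Walk (KvvI v) (join v v t) z k → Walk (KvvI v) (join v v s) z (suc k)
join-step {v} s t adj = step (subst₂ KvvI-adj (sym (splitAt-join v v s)) (sym (splitAt-join v v t)) adj)

splitAt-injective : ∀ m {n} {x y : Fin (m + n)} → splitAt m x ≡ splitAt m y → x ≡ y
splitAt-injective m {n} {x} {y} eq = begin
  x                      ≡⟨ join-splitAt m n x ⟨
  join m n (splitAt m x) ≡⟨ cong (join m n) eq ⟩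
  join m n (splitAt m y) ≡⟨ join-splitAt m n y ⟩
  y                      ∎
  where open ≡-Reasoning

module _ {n : ℕ} where
  private
    v : ℕ
    v = 3 + n

  δ-walk : (s t : Fin v ⊎ Fin v) → Walk (KvvI v) (join v v s) (join v v t) (δ s t)
  δ-walk (inj₁ i) (inj₁ j) with i ≟ j
  ... | yes refl = here
  ... | no _ with third i j
  ...   | k , k≢i , k≢j = join-step (inj₁ i) (inj₂ k) (k≢i ∘ sym) (join-step (inj₂ k) (inj₁ j) k≢j here)
  δ-walk (inj₂ i) (inj₂ j) with i ≟ j
  ... | yes refl = here
  ... | no _ with third i j
  ...   | k , k≢i , k≢j = join-step (inj₂ i) (inj₁ k) (k≢i ∘ sym) (join-step (inj₁ k) (inj₂ j) k≢j here)
  δ-walk (inj₁ i) (inj₂ j) with i ≟ j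
  ... | no i≢j = join-step (inj₁ i) (inj₂ j) i≢j here
  ... | yes refl with third i i
  ...   | k , k≢i , _ with third i k
  ...     | l , l≢i , l≢k = join-step (inj₁ i) (inj₂ k) (k≢i ∘ sym)
                              (join-step (inj₂ k) (inj₁ l) (l≢k ∘ sym) (join-step (inj₁ l) (inj₂ i) l≢i here))
  δ-walk (inj₂ i) (inj₁ j) with i ≟ j
  ... | no i≢j = join-step (inj₂ i) (inj₁ j) i≢j here
  ... | yes refl with third i i
  ...   | k , k≢i , _ with third i k
  ...     | l , l≢i , l≢k = join-step (inj₂ i) (inj₁ k) (k≢i ∘ sym)
                              (join-step (inj₁ k) (inj₂ l) (l≢k ∘ sym) (join-step (inj₂ l) (inj₁ i) l≢i here))

  KvvI-IsDist : (x y : Fin (v + v)) → IsDist (KvvI v) x y (δ (splitAt v x) (splitAt v y))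
  KvvI-IsDist x y =
    IsDist-fromPotential (λ x y → δ (splitAt v x) (splitAt v y)) (δ-diag ∘ splitAt v) (δ-step ∘ splitAt v)
      (subst₂ (λ x′ y′ → Walk (KvvI v) x′ y′ (δ (splitAt v x) (splitAt v y)))
              (join-splitAt v v x) (join-splitAt v v y)
              (δ-walk (splitAt v x) (splitAt v y)))

  landmarks : Subset (v + v)
  landmarks = (outside ∷ ⊤ {2 + n}) ++ ⊥

  ∣landmarks∣ : ∣ landmarks ∣ ≡ v ∸ 1
  ∣landmarks∣ = begin
    ∣ landmarks ∣                   ≡⟨ ∣p++q∣≡∣p∣+∣q∣ (outside ∷ ⊤ {2 + n}) ⊥ ⟩
    ∣ ⊤ {2 + n} ∣ + ∣ ⊥ {v} ∣       ≡⟨ cong₂ _+_ (∣⊤∣≡n (2 + n)) (∣⊥∣≡0 v) ⟩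
    2 + n + 0                       ≡⟨ +-identityʳ (2 + n) ⟩
    2 + n                           ∎
    where open ≡-Reasoning

  landmarks-resolving : Resolving (KvvI v) landmarks
  landmarks-resolving x y x≢y with δ-separates (splitAt v x) (splitAt v y) (x≢y ∘ splitAt-injective v)
  ... | k , distinct =
    fsuc k ↑ˡ v , ↑ˡ-∈-++⁺ ⊥ (there ∈⊤) , _ , _ , KvvI-IsDist x (fsuc k ↑ˡ v) , KvvI-IsDist y (fsuc k ↑ˡ v) ,
    subst (λ u → δ (splitAt v x) u ≢ δ (splitAt v y) u) (sym (splitAt-↑ˡ v (fsuc k) v)) distinct

  resolving⇒pairwise-hit : (p q : Subset v) → Resolving (KvvI v) (p ++ q) →
                           ∀ i j → i ≢ j → i ∈ p ∪ q ⊎ j ∈ p ∪ q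
  resolving⇒pairwise-hit p q resolving i j i≢j
    with resolving (i ↑ˡ v) (j ↑ˡ v) (i≢j ∘ ↑ˡ-injective v i j)
  ... | w , w∈ , _ , _ , distᵢ , distⱼ , dᵢ≢dⱼ =
    Sum.map (λ u≡i → subst (_∈ p ∪ q) u≡i u∈) (λ u≡j → subst (_∈ p ∪ q) u≡j u∈)
            (δ-a-distinguisher-index i j u λ eq → dᵢ≢dⱼ (trans (δ-from distᵢ) (trans eq (sym (δ-from distⱼ)))))
    where
    u : Fin v ⊎ Fin v
    u = splitAt v w
    u∈ : reduce u ∈ p ∪ q
    u∈ = ∈-++⇒reduce-splitAt-∈-∪ p q w w∈
    δ-from : ∀ {i d} → IsDist (KvvI v) (i ↑ˡ v) w d → d ≡ δ (inj₁ i) u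
    δ-from {i} dist = trans (IsDist-unique dist (KvvI-IsDist (i ↑ˡ v) w)) (cong (λ s → δ s u) (splitAt-↑ˡ v i v))

  resolving⇒size : (R : Subset (v + v)) → Resolving (KvvI v) R → v ∸ 1 ≤ ∣ R ∣
  resolving⇒size R resolving with Vec.splitAt v R
  ... | p , q , refl = begin
    v ∸ 1         ≤⟨ pairwise-hit⇒n∸1≤∣p∣ (p ∪ q) (resolving⇒pairwise-hit p q resolving) ⟩
    ∣ p ∪ q ∣     ≤⟨ ∣p∪q∣≤∣p∣+∣q∣ p q ⟩
    ∣ p ∣ + ∣ q ∣ ≡⟨ ∣p++q∣≡∣p∣+∣q∣ p q ⟨
    ∣ p ++ q ∣    ∎
    where open ≤-Reasoning

corollary2p7 : ∀ (v : ℕ) → 3 ≤ v → MetricDimension (KvvI v) (v ∸ 1)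
corollary2p7 (suc (suc (suc n))) (s≤s (s≤s (s≤s z≤n))) =
  (landmarks , landmarks-resolving , ∣landmarks∣) , resolving⇒size
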